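{- Let $p$ be a prime, $q=p^{r}$, $k\geq 3$ with $k\mid(q-1)$, $m=(q-1)/k$, $F=\mathrm{GF}(q)$, $\zeta$ a generator of $F^{*}$, $\varphi=\zeta^{m}$, and $\Phi=\langle\varphi\rangle$ the subgroup of order $k$. For $i,j\in\{1,\dots,k-1\}$ let $c_{j,i}=(\varphi^{j}-1)^{ -1}(\varphi^{i}-1)$. Suppose $(F,\Phi)$ is circular and let $j\in\{1,\dots,k-1\}$. (1) If $k$ is even, then $|(\Phi+1)\cap(\Phi+\varphi^{j})|$ equals $2$ if $1\in\Phi c_{j,i}$ for some $i\in\{1,\dots,k-1\}\setminus\{k/2\}$; equals $1$ if $1\in\Phi c_{j,k/2}$; and equals $0$ otherwise. (2) If $k$ is odd, then $|(\Phi+1)\cap(\Phi+\varphi^{j})|$ equals $2$ if $p=2$ and $1\in\Phi c_{j,i}$ for some $i\in\{1,\dots,k-1\}$; equals $1$ if $p\neq 2$ and $1\in\Phi c_{j,i}$ for some $i\in\{1,\dots,k-1\}$; and equals $0$ otherwise.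
   Context: The pair $(F,\Phi)$ is circular if $|\Phi a\cap(\Phi b+c)|\leq 2$ for all $a,b,c\in F^{*}$. -}

module Defs where

open import Level using (0ℓ)
open import Data.Nat as ℕ using (ℕ; zero; suc)
open import Data.Fin using (Fin; toℕ)
open import Data.Fin.Properties using (any?)
open import Data.List using (List; length; filter)
open import Data.Fin.Base using ()
open import Data.List using (allFin) renaming (map to lmap)
open import Data.Product using (Σ; ∃; ∃-syntax; _×_; _,_)
open import Relation.Nullary using (Dec; ¬_)
open import Relation.Nullary.Decidable using (_×-dec_)
open import Relation.Binary.PropositionalEquality using (_≡_; _≢_)
open import Relation.Binary.Definitions using (DecidableEquality)
open import Relation.Unary using (Pred; Decidable)
open import Algebra.Structures using (IsCommutativeRing)
open import Function.Bundles using (_↔_; Inverse)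

record FiniteField : Set₁ where
  infixl 7 _*_
  infixl 6 _+_ _-_
  field
    Carrier : Set
    _+_ _*_ : Carrier → Carrier → Carrier
    -_      : Carrier → Carrier
    0# 1#   : Carrier
    _⁻¹     : Carrier → Carrier
    isCommutativeRing : IsCommutativeRing _≡_ _+_ _*_ -_ 0# 1#
    0≢1     : 0# ≢ 1#
    ⁻¹-inverse : ∀ x → x ≢ 0# → x * (x ⁻¹) ≡ 1#
    _≟_     : DecidableEquality Carrier
    size    : ℕ
    enum    : Carrier ↔ Fin size

  _-_ : Carrier → Carrier → Carrier
  x - y = x + (- y)

  _^_ : Carrier → ℕ → Carrier
  x ^ zero  = 1#
  x ^ suc n = x * (x ^ n)

  card : (S : Pred Carrier 0ℓ) → Decidable S → ℕ
  card S S? = length (filter (λ i → S? (Inverse.from enum i)) (allFin size))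

  IsGenerator : Carrier → Set
  IsGenerator ζ = ∀ x → x ≢ 0# → ∃[ n ] x ≡ ζ ^ n

  module Cyclic (φ : Carrier) (k : ℕ) where
    -- Φ = ⟨φ⟩ = { φ^t : 0 ≤ t < k } (φ of order k)
    -- Coset a c = Φ a + c = { φ^t * a + c : t < k }
    Coset : Carrier → Carrier → Pred Carrier 0ℓ
    Coset a c x = ∃[ t ] x ≡ φ ^ toℕ {k} t * a + c

    Coset? : ∀ a c → Decidable (Coset a c)
    Coset? a c x = any? (λ t → x ≟ (φ ^ toℕ t * a + c))

    cardInter : Carrier → Carrier → Carrier → Carrier → ℕ
    cardInter a c b d =
      card (λ x → Coset a c x × Coset b d x) (λ x → Coset? a c x ×-dec Coset? b d x)

    Circular : Set
    Circular = ∀ a b c → a ≢ 0# → b ≢ 0# → c ≢ 0# → cardInter a 0# b c ℕ.≤ 2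

-- Write Inter = (Φ + 1) ∩ (Φ + φʲ). It always contains φʲ + 1, and it contains 0 as soon as
-- -1 ∈ Φ. Translating by -1 maps it into Φ ∩ (Φ + (φʲ - 1)), so circularity allows at most two
-- points. Hence if -1 ∈ Φ then Inter = {φʲ + 1, 0}; these coincide when φʲ = -1, and then Inter
-- is closed under x ↦ -x, which with at most two points forces Inter = {0}. If -1 ∉ Φ, a point
-- x = φˢ + 1 = φᵗ + φʲ yields the points φˢ, 1, φᵗ, φʲ of Φ ∩ (x - Φ), and circularity forces
-- φˢ = φʲ, so Inter = {φʲ + 1}. For k = 2h we have φʰ = -1; for k odd, -1 ∈ Φ iff -1 = 1, which
-- (ζ having order q - 1) happens iff q is even, i.e. p = 2. Finally 1 ∈ Φ c_{j,i} means
-- φᵗ (φⁱ - 1) = φʲ - 1, which puts φᵗ + φʲ = φᵗ⁺ⁱ + 1 into Inter; when φⁱ or φʲ is -1 this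
-- forces φᵗ = 1 and i = j. As c_{j,j} = 1, the case "no such i" never occurs.

module Submission where

open import Defs
open import Level using (0ℓ)
open import Algebra.Bundles using (CommutativeRing)
open import Data.Nat as ℕ using (ℕ; zero; suc; _≤_; _<_; _∸_; z≤n; s≤s; NonZero; >-nonZero; >-nonZero⁻¹)
open import Data.Nat.Properties as ℕ
  using (≤-trans; <-≤-trans; ≤-antisym; <-irrefl; ≤-total; <⇒≤; m<n⇒0<n∸m; m∸n≤m; m+[n∸m]≡n;
         m∸n≡0⇒m≤n; *-suc; *-monoʳ-<; *-zeroʳ; m*n≢0⇒m≢0; m*n≢0⇒n≢0; n<1+n; m≤n⇒m≤1+n; +-suc)
open import Data.Nat.DivMod using (_%_; _/_; m≡m%n+[m/n]*n; m%n<n)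
open import Data.Nat.Divisibility using (_∣_; divides; m%n≡0⇒n∣m; ∣1⇒≡1; ∣m+n∣m⇒∣n; m∣m*n; ∣⇒≤)
open import Data.Nat.Coprimality using (Coprime; coprime-divisor)
open import Data.Nat.Primality using (Prime; prime[2]; ¬prime[1]; euclidsLemma; prime⇒irreducible)
open import Data.Fin using (Fin; toℕ; fromℕ<; punchIn; punchOut)
open import Data.Fin.Properties
  using (¬Fin0; toℕ-fromℕ<; toℕ≤pred[n]; punchInᵢ≢i; punchIn-injective; punchOut-injective;
         injective⇒≤; pigeonhole)
  renaming (_≟_ to _≟ᶠ_)
open import Data.List using ([]; _∷_; length; filter; allFin)
open import Data.List.Properties using (filter-≐; filter-none)
open import Data.List.Relation.Unary.All as All using (All)
open import Data.List.Relation.Unary.Any using (here; there)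
open import Data.List.Relation.Unary.AllPairs using (_∷_)
open import Data.List.Relation.Unary.Unique.Propositional using (Unique)
open import Data.List.Relation.Unary.Unique.Propositional.Properties using (allFin⁺)
open import Data.List.Membership.Propositional using (_∈_)
open import Data.List.Membership.Propositional.Properties using (∈-allFin)
open import Data.Product using (∃-syntax; _×_; _,_; proj₁; proj₂)
open import Data.Sum using (_⊎_; inj₁; inj₂; [_,_]′)
open import Data.Empty using (⊥; ⊥-elim)
open import Function.Base using (_∘_; id)
open import Function.Bundles using (_↔_; _⇔_; mk⇔; Inverse; Equivalence)
open import Relation.Nullary using (yes; no; ¬_; contradiction)
open import Relation.Unary using (Pred; Decidable; _⊆_; _≐_; _∪_; _∩_)
open import Relation.Unary.Properties using (_∪?_; _∩?_)
open import Relation.Binary.Definitions using (DecidableEquality)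
open import Relation.Binary.PropositionalEquality
  using (_≡_; _≢_; refl; sym; trans; cong; cong₂; subst; module ≡-Reasoning)

-- Parity and prime powers

2∣⊎2∣suc : ∀ n → 2 ∣ n ⊎ 2 ∣ suc n
2∣⊎2∣suc zero = inj₁ (divides 0 refl)
2∣⊎2∣suc (suc n) with 2∣⊎2∣suc n
... | inj₁ (divides q n≡q*2) = inj₂ (divides (suc q) (cong (2 ℕ.+_) n≡q*2))
... | inj₂ 2∣1+n = inj₁ 2∣1+n

2∣suc⇔¬2∣ : ∀ n → 2 ∣ suc n ⇔ (¬ 2 ∣ n)
2∣suc⇔¬2∣ n = mk⇔
  (λ 2∣1+n 2∣n → contradiction (∣1⇒≡1 (∣m+n∣m⇒∣n (subst (2 ∣_) (ℕ.+-comm 1 n) 2∣1+n) 2∣n)) λ ())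
  (λ 2∤n → [ (λ 2∣n → contradiction 2∣n 2∤n) , id ]′ (2∣⊎2∣suc n))

prime∣^⇒∣ : ∀ {q m} → Prime q → ∀ r → q ∣ m ℕ.^ r → q ∣ m
prime∣^⇒∣ q-prime zero q∣1 = contradiction (subst Prime (∣1⇒≡1 q∣1) q-prime) ¬prime[1]
prime∣^⇒∣ {m = m} q-prime (suc r) q∣mᵣ₊₁ with euclidsLemma m (m ℕ.^ r) q-prime q∣mᵣ₊₁
... | inj₁ q∣m = q∣m
... | inj₂ q∣mʳ = prime∣^⇒∣ q-prime r q∣mʳ

2∣prime^⇔≡2 : ∀ {p} → Prime p → ∀ r → 2 ∣ p ℕ.^ suc r ⇔ p ≡ 2
2∣prime^⇔≡2 p-prime r = mk⇔
  (λ 2∣pʳ⁺¹ → [ (λ ()) , sym ]′ (prime⇒irreducible p-prime (prime∣^⇒∣ prime[2] (suc r) 2∣pʳ⁺¹)))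
  (λ { refl → m∣m*n (2 ℕ.^ r) })

n≡2*h⇒0<h<n : ∀ {n} h → 0 < n → n ≡ 2 ℕ.* h → 0 < h × h < n
n≡2*h⇒0<h<n zero 0<n n≡0 = contradiction (sym n≡0) (ℕ.<⇒≢ 0<n)
n≡2*h⇒0<h<n (suc h) _ n≡2h = s≤s z≤n , subst (suc h <_) (sym n≡2h) (ℕ.m<m+n (suc h) (s≤s z≤n))

-- Counting with filter

module _ {A : Set} {P Q : Pred A 0ℓ} (P? : Decidable P) (Q? : Decidable Q) where

  length-filter-⊆ : P ⊆ Q → ∀ xs → length (filter P? xs) ≤ length (filter Q? xs)
  length-filter-⊆ P⊆Q [] = z≤n
  length-filter-⊆ P⊆Q (x ∷ xs) with P? x | Q? x
  ... | yes _  | yes _  = s≤s (length-filter-⊆ P⊆Q xs)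
  ... | yes px | no ¬qx = contradiction (P⊆Q px) ¬qx
  ... | no _   | yes _  = m≤n⇒m≤1+n (length-filter-⊆ P⊆Q xs)
  ... | no _   | no _   = length-filter-⊆ P⊆Q xs

  length-filter-∪ : (∀ {x} → P x → ¬ Q x) → ∀ xs →
    length (filter (P? ∪? Q?) xs) ≡ length (filter P? xs) ℕ.+ length (filter Q? xs)
  length-filter-∪ disjoint [] = refl
  length-filter-∪ disjoint (x ∷ xs) with P? x | Q? x
  ... | yes px | yes qx = contradiction qx (disjoint px)
  ... | yes _  | no _   = cong suc (length-filter-∪ disjoint xs)
  ... | no _   | yes _  = trans (cong suc (length-filter-∪ disjoint xs)) (sym (+-suc _ _))
  ... | no _   | no _   = length-filter-∪ disjoint xs

module _ {A : Set} (_≟_ : DecidableEquality A) where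

  length-filter-≡ : ∀ {a xs} → Unique xs → a ∈ xs → length (filter (_≟ a) xs) ≡ 1
  length-filter-≡ {xs = x ∷ xs} (x∉xs ∷ _) (here refl) with x ≟ x
  ... | yes _ = cong suc (cong length (filter-none (_≟ x) (All.map (λ x≢y y≡x → x≢y (sym y≡x)) x∉xs)))
  ... | no x≢x = contradiction refl x≢x
  length-filter-≡ {a} {x ∷ xs} (x∉xs ∷ xs!) (there a∈xs) with x ≟ a
  ... | yes x≡a = contradiction x≡a (All.lookup x∉xs a∈xs)
  ... | no _ = length-filter-≡ xs! a∈xs

module FiniteFieldProperties (F : FiniteField) where
  open FiniteField F

  commutativeRing : CommutativeRing 0ℓ 0ℓ
  commutativeRing = record { isCommutativeRing = isCommutativeRing }

  open CommutativeRing commutativeRing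
    using ( +-assoc; +-comm; +-identityʳ; -‿inverseˡ; -‿inverseʳ
          ; *-assoc; *-comm; *-identityˡ; *-identityʳ; distribʳ; zeroˡ; zeroʳ)
  open import Algebra.Properties.Ring (CommutativeRing.ring commutativeRing)
    using ( -‿involutive; -‿distribˡ-*; -‿+-comm; -0#≈0#; -1*x≈-x
          ; +-cancelʳ; +-inverseˡ-unique; +-inverseʳ-unique; x∙y⁻¹≈ε⇒x≈y; x≈y⇒x∙y⁻¹≈ε; x[y-z]≈xy-xz; ⁻¹-anti-homo‿-)

  open ≡-Reasoning

  1≢0 : 1# ≢ 0#
  1≢0 = 0≢1 ∘ sym

  -1≢0 : - 1# ≢ 0#
  -1≢0 -1≡0 = 1≢0 (trans (sym (-‿involutive 1#)) (trans (cong -_ -1≡0) -0#≈0#))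

  x⁻¹*x≡1 : ∀ {x} → x ≢ 0# → x ⁻¹ * x ≡ 1#
  x⁻¹*x≡1 {x} x≢0 = trans (*-comm (x ⁻¹) x) (⁻¹-inverse x x≢0)

  x*y≡0⇒x≡0⊎y≡0 : ∀ x y → x * y ≡ 0# → x ≡ 0# ⊎ y ≡ 0#
  x*y≡0⇒x≡0⊎y≡0 x y xy≡0 with x ≟ 0#
  ... | yes x≡0 = inj₁ x≡0
  ... | no x≢0 = inj₂ (begin
    y               ≡⟨ *-identityˡ y ⟨
    1# * y          ≡⟨ cong (_* y) (x⁻¹*x≡1 x≢0) ⟨
    x ⁻¹ * x * y    ≡⟨ *-assoc (x ⁻¹) x y ⟩
    x ⁻¹ * (x * y)  ≡⟨ cong (x ⁻¹ *_) xy≡0 ⟩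
    x ⁻¹ * 0#       ≡⟨ zeroʳ (x ⁻¹) ⟩
    0#              ∎)

  x*y≢0 : ∀ {x y} → x ≢ 0# → y ≢ 0# → x * y ≢ 0#
  x*y≢0 {x} {y} x≢0 y≢0 xy≡0 with x*y≡0⇒x≡0⊎y≡0 x y xy≡0
  ... | inj₁ x≡0 = x≢0 x≡0
  ... | inj₂ y≡0 = y≢0 y≡0

  *-cancelˡ : ∀ {x y} a → a ≢ 0# → a * x ≡ a * y → x ≡ y
  *-cancelˡ {x} {y} a a≢0 ax≡ay with x*y≡0⇒x≡0⊎y≡0 a (x - y)
    (trans (x[y-z]≈xy-xz a x y) (x≈y⇒x∙y⁻¹≈ε ax≡ay))
  ... | inj₁ a≡0 = contradiction a≡0 a≢0
  ... | inj₂ x-y≡0 = x∙y⁻¹≈ε⇒x≈y x y x-y≡0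

  *-cancelʳ : ∀ {x y} a → a ≢ 0# → x * a ≡ y * a → x ≡ y
  *-cancelʳ {x} {y} a a≢0 xa≡ya = *-cancelˡ a a≢0 (trans (*-comm a x) (trans xa≡ya (*-comm y a)))

  x*x≡1⇒x≡±1 : ∀ {x} → x * x ≡ 1# → x ≡ 1# ⊎ x ≡ - 1#
  x*x≡1⇒x≡±1 {x} xx≡1 with (x - 1#) ≟ 0#
  ... | yes x-1≡0 = inj₁ (x∙y⁻¹≈ε⇒x≈y x 1# x-1≡0)
  ... | no x-1≢0 = inj₂ (*-cancelʳ (x - 1#) x-1≢0 (begin
    x * (x - 1#)        ≡⟨ x[y-z]≈xy-xz x x 1# ⟩
    x * x - x * 1#      ≡⟨ cong₂ _-_ xx≡1 (*-identityʳ x) ⟩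
    1# - x              ≡⟨ ⁻¹-anti-homo‿- x 1# ⟨
    - (x - 1#)          ≡⟨ -1*x≈-x (x - 1#) ⟨
    - 1# * (x - 1#)     ∎))

  x+x≡[1+1]*x : ∀ x → x + x ≡ (1# + 1#) * x
  x+x≡[1+1]*x x = sym (trans (distribʳ x 1# 1#) (cong₂ _+_ (*-identityˡ x) (*-identityˡ x)))

  x+x≡y+y⇒x≡y : - 1# ≢ 1# → ∀ {x y} → x + x ≡ y + y → x ≡ y
  x+x≡y+y⇒x≡y -1≢1 {x} {y} eq =
    *-cancelˡ (1# + 1#) 1+1≢0 (trans (sym (x+x≡[1+1]*x x)) (trans eq (x+x≡[1+1]*x y)))
    where
    1+1≢0 : 1# + 1# ≢ 0#
    1+1≢0 1+1≡0 = -1≢1 (sym (+-inverseˡ-unique 1# 1# 1+1≡0))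

  x*-1≡-x : ∀ x → x * - 1# ≡ - x
  x*-1≡-x x = trans (*-comm x (- 1#)) (-1*x≈-x x)

  x-y+y≡x : ∀ x y → x - y + y ≡ x
  x-y+y≡x x y = trans (+-assoc x (- y) y) (trans (cong (x +_) (-‿inverseˡ y)) (+-identityʳ x))

  -y+[x+y]≡x : ∀ x y → - y + (x + y) ≡ x
  -y+[x+y]≡x x y =
    trans (+-comm (- y) (x + y)) (trans (+-assoc x y (- y)) (trans (cong (x +_) (-‿inverseʳ y)) (+-identityʳ x)))

  a-b≡c-d⇒a+d≡b+c : ∀ {a b c d} → a - b ≡ c - d → a + d ≡ b + c
  a-b≡c-d⇒a+d≡b+c {a} {b} {c} {d} eq = begin
    a + d                 ≡⟨ cong (_+ d) (x-y+y≡x a b) ⟨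
    a - b + b + d         ≡⟨ cong (λ z → z + b + d) eq ⟩
    c - d + b + d         ≡⟨ +-assoc (c - d) b d ⟩
    c - d + (b + d)       ≡⟨ cong (c - d +_) (+-comm b d) ⟩
    c - d + (d + b)       ≡⟨ +-assoc (c - d) d b ⟨
    c - d + d + b         ≡⟨ cong (_+ b) (x-y+y≡x c d) ⟩
    c + b                 ≡⟨ +-comm c b ⟩
    b + c                 ∎

  a*[x⁻¹*y]≡1⇒a*y≡x : ∀ {a x y} → x ≢ 0# → a * (x ⁻¹ * y) ≡ 1# → a * y ≡ x
  a*[x⁻¹*y]≡1⇒a*y≡x {a} {x} {y} x≢0 eq = begin
    a * y                   ≡⟨ *-identityˡ (a * y) ⟨
    1# * (a * y)            ≡⟨ cong (_* (a * y)) (⁻¹-inverse x x≢0) ⟨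
    x * x ⁻¹ * (a * y)      ≡⟨ *-assoc x (x ⁻¹) (a * y) ⟩
    x * (x ⁻¹ * (a * y))    ≡⟨ cong (x *_) (swap a (x ⁻¹) y) ⟩
    x * (a * (x ⁻¹ * y))    ≡⟨ cong (x *_) eq ⟩
    x * 1#                  ≡⟨ *-identityʳ x ⟩
    x                       ∎
    where
    swap : ∀ u v w → v * (u * w) ≡ u * (v * w)
    swap u v w = trans (sym (*-assoc v u w)) (trans (cong (_* w) (*-comm v u)) (*-assoc u v w))

  ^-homo-* : ∀ g m n → g ^ (m ℕ.+ n) ≡ g ^ m * g ^ n
  ^-homo-* g zero n = sym (*-identityˡ (g ^ n))
  ^-homo-* g (suc m) n = trans (cong (g *_) (^-homo-* g m n)) (sym (*-assoc g (g ^ m) (g ^ n)))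

  ^-assocʳ : ∀ g m n → (g ^ m) ^ n ≡ g ^ (m ℕ.* n)
  ^-assocʳ g m zero = cong (g ^_) (sym (*-zeroʳ m))
  ^-assocʳ g m (suc n) = begin
    g ^ m * (g ^ m) ^ n       ≡⟨ cong (g ^ m *_) (^-assocʳ g m n) ⟩
    g ^ m * g ^ (m ℕ.* n)     ≡⟨ ^-homo-* g m (m ℕ.* n) ⟨
    g ^ (m ℕ.+ m ℕ.* n)       ≡⟨ cong (g ^_) (*-suc m n) ⟨
    g ^ (m ℕ.* suc n)         ∎

  1^n≡1 : ∀ n → 1# ^ n ≡ 1#
  1^n≡1 zero = refl
  1^n≡1 (suc n) = trans (*-identityˡ (1# ^ n)) (1^n≡1 n)

  ^≢0 : ∀ {g} n → g ≢ 0# → g ^ n ≢ 0#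
  ^≢0 zero g≢0 = 1≢0
  ^≢0 (suc n) g≢0 = x*y≢0 g≢0 (^≢0 n g≢0)

  ^-cancel : ∀ {g m n} → g ≢ 0# → m ≤ n → g ^ m ≡ g ^ n → g ^ (n ∸ m) ≡ 1#
  ^-cancel {g} {m} {n} g≢0 m≤n gᵐ≡gⁿ = *-cancelˡ (g ^ m) (^≢0 m g≢0) (begin
    g ^ m * g ^ (n ∸ m)   ≡⟨ ^-homo-* g m (n ∸ m) ⟨
    g ^ (m ℕ.+ (n ∸ m))   ≡⟨ cong (g ^_) (m+[n∸m]≡n m≤n) ⟩
    g ^ n                 ≡⟨ gᵐ≡gⁿ ⟨
    g ^ m                 ≡⟨ *-identityʳ (g ^ m) ⟨
    g ^ m * 1#            ∎)

  ^-mod : ∀ {g e} .{{_ : NonZero e}} → g ^ e ≡ 1# → ∀ n → g ^ n ≡ g ^ (n % e)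
  ^-mod {g} {e} gᵉ≡1 n = begin
    g ^ n                                ≡⟨ cong (g ^_) (m≡m%n+[m/n]*n n e) ⟩
    g ^ (n % e ℕ.+ n / e ℕ.* e)          ≡⟨ ^-homo-* g (n % e) (n / e ℕ.* e) ⟩
    g ^ (n % e) * g ^ (n / e ℕ.* e)      ≡⟨ cong (λ z → g ^ (n % e) * g ^ z) (ℕ.*-comm (n / e) e) ⟩
    g ^ (n % e) * g ^ (e ℕ.* (n / e))    ≡⟨ cong (g ^ (n % e) *_) (^-assocʳ g e (n / e)) ⟨
    g ^ (n % e) * (g ^ e) ^ (n / e)      ≡⟨ cong (λ z → g ^ (n % e) * z ^ (n / e)) gᵉ≡1 ⟩
    g ^ (n % e) * 1# ^ (n / e)           ≡⟨ cong (g ^ (n % e) *_) (1^n≡1 (n / e)) ⟩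
    g ^ (n % e) * 1#                     ≡⟨ *-identityʳ (g ^ (n % e)) ⟩
    g ^ (n % e)                          ∎

  -- Multiplicative order

  record HasOrder (g : Carrier) (o : ℕ) : Set where
    field
      0<o     : 0 < o
      ^o≡1    : g ^ o ≡ 1#
      minimal : ∀ {e} → 0 < e → e < o → g ^ e ≢ 1#

  ^-double : ∀ g n → g ^ (2 ℕ.* n) ≡ g ^ n * g ^ n
  ^-double g n = trans (^-homo-* g n (n ℕ.+ 0)) (cong (λ z → g ^ n * g ^ z) (ℕ.+-identityʳ n))

  -1*-1≡1 : - 1# * - 1# ≡ 1#
  -1*-1≡1 = trans (-1*x≈-x (- 1#)) (-‿involutive 1#)

  module HasOrderProperties {g o} (order : HasOrder g o) where
    open HasOrder order

    instance
      o≢0 : NonZero o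
      o≢0 = >-nonZero 0<o

    g≢0 : g ≢ 0#
    g≢0 g≡0 = 1≢0 (begin
      1#                   ≡⟨ ^o≡1 ⟨
      g ^ o                ≡⟨ cong (g ^_) (ℕ.suc-pred o) ⟨
      g * g ^ ℕ.pred o     ≡⟨ cong (_* g ^ ℕ.pred o) g≡0 ⟩
      0# * g ^ ℕ.pred o    ≡⟨ zeroˡ (g ^ ℕ.pred o) ⟩
      0#                   ∎)

    ^≡1⇒≡0 : ∀ {e} → e < o → g ^ e ≡ 1# → e ≡ 0
    ^≡1⇒≡0 {zero} _ _ = refl
    ^≡1⇒≡0 {suc e} e<o gᵉ≡1 = contradiction gᵉ≡1 (minimal (s≤s z≤n) e<o)

    private
      ^≡^⇒≥ : ∀ {m n} → m ≤ n → n < o → g ^ m ≡ g ^ n → n ≤ m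
      ^≡^⇒≥ {m} {n} m≤n n<o gᵐ≡gⁿ =
        m∸n≡0⇒m≤n (^≡1⇒≡0 (ℕ.≤-<-trans (m∸n≤m n m) n<o) (^-cancel g≢0 m≤n gᵐ≡gⁿ))

    ^-injective : ∀ {m n} → m < o → n < o → g ^ m ≡ g ^ n → m ≡ n
    ^-injective {m} {n} m<o n<o gᵐ≡gⁿ with ≤-total m n
    ... | inj₁ m≤n = ≤-antisym m≤n (^≡^⇒≥ m≤n n<o gᵐ≡gⁿ)
    ... | inj₂ n≤m = sym (≤-antisym n≤m (^≡^⇒≥ n≤m m<o (sym gᵐ≡gⁿ)))

    ^≡1⇒∣ : ∀ {e} → g ^ e ≡ 1# → o ∣ e
    ^≡1⇒∣ {e} gᵉ≡1 = m%n≡0⇒n∣m e o (^≡1⇒≡0 (m%n<n e o) (trans (sym (^-mod ^o≡1 e)) gᵉ≡1))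

    ∣⇒^≡1 : ∀ {e} → o ∣ e → g ^ e ≡ 1#
    ∣⇒^≡1 (divides q refl) = begin
      g ^ (q ℕ.* o)      ≡⟨ cong (g ^_) (ℕ.*-comm q o) ⟩
      g ^ (o ℕ.* q)      ≡⟨ ^-assocʳ g o q ⟨
      (g ^ o) ^ q        ≡⟨ cong (_^ q) ^o≡1 ⟩
      1# ^ q             ≡⟨ 1^n≡1 q ⟩
      1#                 ∎

    ^half≢1 : ∀ h → o ≡ 2 ℕ.* h → g ^ h ≢ 1#
    ^half≢1 h o≡2h = minimal {h} (proj₁ bounds) (proj₂ bounds)
      where
      bounds : 0 < h × h < o
      bounds = n≡2*h⇒0<h<n h 0<o o≡2h

    ^half≡-1 : ∀ h → o ≡ 2 ℕ.* h → g ^ h ≡ - 1#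
    ^half≡-1 h o≡2h with x*x≡1⇒x≡±1 (trans (sym (^-double g h)) (trans (cong (g ^_) (sym o≡2h)) ^o≡1))
    ... | inj₁ gʰ≡1 = contradiction gʰ≡1 (^half≢1 h o≡2h)
    ... | inj₂ gʰ≡-1 = gʰ≡-1

    even-order⇒-1≢1 : 2 ∣ o → - 1# ≢ 1#
    even-order⇒-1≢1 (divides h o≡h*2) -1≡1 = ^half≢1 h o≡2h (trans (^half≡-1 h o≡2h) -1≡1)
      where
      o≡2h : o ≡ 2 ℕ.* h
      o≡2h = trans o≡h*2 (ℕ.*-comm h 2)

    odd-order⇒-1≡1 : ¬ 2 ∣ o → ∀ n → g ^ n ≡ - 1# → - 1# ≡ 1#
    odd-order⇒-1≡1 2∤o n gⁿ≡-1 = trans (sym gⁿ≡-1) (∣⇒^≡1 {n} (coprime-divisor coprime (^≡1⇒∣ {2 ℕ.* n} g²ⁿ≡1)))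
      where
      coprime : Coprime o 2
      coprime (d∣o , d∣2) with prime⇒irreducible prime[2] d∣2
      ... | inj₁ d≡1 = d≡1
      ... | inj₂ refl = contradiction d∣o 2∤o
      g²ⁿ≡1 : g ^ (2 ℕ.* n) ≡ 1#
      g²ⁿ≡1 = trans (^-double g n) (trans (cong₂ _*_ gⁿ≡-1 gⁿ≡-1) -1*-1≡1)

    ^-hasOrder : ∀ m {k} → o ≡ m ℕ.* k → HasOrder (g ^ m) k
    ^-hasOrder m {k} o≡mk = record
      { 0<o     = >-nonZero⁻¹ k {{m*n≢0⇒n≢0 m}}
      ; ^o≡1    = trans (^-assocʳ g m k) (trans (cong (g ^_) (sym o≡mk)) ^o≡1)
      ; minimal = λ {e} 0<e e<k gᵐᵉ≡1 → minimal (0<me 0<e) (subst (m ℕ.* e <_) (sym o≡mk) (*-monoʳ-< m e<k))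
                                         (trans (sym (^-assocʳ g m e)) gᵐᵉ≡1)
      }
      where
      instance
        mk≢0 : NonZero (m ℕ.* k)
        mk≢0 = subst NonZero o≡mk o≢0
        m≢0 : NonZero m
        m≢0 = m*n≢0⇒m≢0 m
      0<me : ∀ {e} → 0 < e → 0 < m ℕ.* e
      0<me {e} 0<e = subst (_< m ℕ.* e) (*-zeroʳ m) (*-monoʳ-< m 0<e)

  -- Cardinalities of decidable subsets

  module _ {S T : Pred Carrier 0ℓ} (S? : Decidable S) (T? : Decidable T) where

    card-≐ : S ≐ T → card S S? ≡ card T T?
    card-≐ (S⊆T , T⊆S) = cong length (filter-≐ _ _ (S⊆T , T⊆S) (allFin size))

    card-⊆ : S ⊆ T → card S S? ≤ card T T?
    card-⊆ S⊆T = length-filter-⊆ _ _ S⊆T (allFin size)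

    card-∪ : (∀ {x} → S x → ¬ T x) → card (S ∪ T) (S? ∪? T?) ≡ card S S? ℕ.+ card T T?
    card-∪ disjoint = length-filter-∪ _ _ disjoint (allFin size)

  card-≡ : ∀ a → card (_≡ a) (_≟ a) ≡ 1
  card-≡ a = trans
    (cong length (filter-≐ _ (_≟ᶠ to a) (from≡⇒≡to , ≡to⇒from≡) (allFin size)))
    (length-filter-≡ _≟ᶠ_ (allFin⁺ size) (∈-allFin (to a)))
    where
    open Inverse enum using (to; from; strictlyInverseˡ; strictlyInverseʳ)
    from≡⇒≡to : ∀ {i} → from i ≡ a → i ≡ to a
    from≡⇒≡to {i} refl = sym (strictlyInverseˡ i)
    ≡to⇒from≡ : ∀ {i} → i ≡ to a → from i ≡ a
    ≡to⇒from≡ refl = strictlyInverseʳ a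

  module _ {S : Pred Carrier 0ℓ} (S? : Decidable S) where

    card-singleton : ∀ {a} → S ≐ (_≡ a) → card S S? ≡ 1
    card-singleton {a} S≐a = trans (card-≐ S? (_≟ a) S≐a) (card-≡ a)

    card-pair : ∀ {a b} → a ≢ b → S ≐ ((_≡ a) ∪ (_≡ b)) → card S S? ≡ 2
    card-pair {a} {b} a≢b S≐ab = begin
      card S S?                                     ≡⟨ card-≐ S? ((_≟ a) ∪? (_≟ b)) S≐ab ⟩
      card ((_≡ a) ∪ (_≡ b)) ((_≟ a) ∪? (_≟ b))     ≡⟨ card-∪ (_≟ a) (_≟ b) (λ { refl → a≢b }) ⟩
      card (_≡ a) (_≟ a) ℕ.+ card (_≡ b) (_≟ b)     ≡⟨ cong₂ ℕ._+_ (card-≡ a) (card-≡ b) ⟩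
      2                                             ∎

    3≤card : ∀ {a b c} → S a → S b → S c → a ≢ b → a ≢ c → b ≢ c → 3 ≤ card S S?
    3≤card {a} {b} {c} Sa Sb Sc a≢b a≢c b≢c = ≤-trans (ℕ.≤-reflexive (sym three))
      (card-⊆ abc? S? λ { (inj₁ refl) → Sa ; (inj₂ (inj₁ refl)) → Sb ; (inj₂ (inj₂ refl)) → Sc })
      where
      bc? : Decidable ((_≡ b) ∪ (_≡ c))
      bc? = (_≟ b) ∪? (_≟ c)
      abc? : Decidable ((_≡ a) ∪ ((_≡ b) ∪ (_≡ c)))
      abc? = (_≟ a) ∪? bc?
      three : card ((_≡ a) ∪ ((_≡ b) ∪ (_≡ c))) abc? ≡ 3
      three = begin
        card ((_≡ a) ∪ ((_≡ b) ∪ (_≡ c))) abc?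
          ≡⟨ card-∪ (_≟ a) bc? (λ { refl (inj₁ a≡b) → a≢b a≡b ; refl (inj₂ a≡c) → a≢c a≡c }) ⟩
        card (_≡ a) (_≟ a) ℕ.+ card ((_≡ b) ∪ (_≡ c)) bc?
          ≡⟨ cong (card (_≡ a) (_≟ a) ℕ.+_) (card-∪ (_≟ b) (_≟ c) λ { refl → b≢c }) ⟩
        card (_≡ a) (_≟ a) ℕ.+ (card (_≡ b) (_≟ b) ℕ.+ card (_≡ c) (_≟ c))
          ≡⟨ cong₂ ℕ._+_ (card-≡ a) (cong₂ ℕ._+_ (card-≡ b) (card-≡ c)) ⟩
        3 ∎

  -- The generator of F*

  to-injective : ∀ {n} (ι : Carrier ↔ Fin n) {x y} → Inverse.to ι x ≡ Inverse.to ι y → x ≡ y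
  to-injective ι {x} {y} eq =
    trans (sym (Inverse.strictlyInverseʳ ι x)) (trans (cong (Inverse.from ι) eq) (Inverse.strictlyInverseʳ ι y))

  nonzero-injection⇒≤ : ∀ {n e} → Carrier ↔ Fin n → (f : ∀ x → x ≢ 0# → Fin e) →
                        (∀ {x y} x≢0 y≢0 → f x x≢0 ≡ f y y≢0 → x ≡ y) → n ∸ 1 ≤ e
  nonzero-injection⇒≤ {zero} _ _ _ = z≤n
  nonzero-injection⇒≤ {suc n} {e} ι f f-injective = injective⇒≤ {f = f′} f′-injective
    where
    open Inverse ι using (to; from; strictlyInverseˡ)
    nonzero : ∀ i → from (punchIn (to 0#) i) ≢ 0#
    nonzero i eq = punchInᵢ≢i (to 0#) i (trans (sym (strictlyInverseˡ _)) (cong to eq))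
    f′ : Fin n → Fin e
    f′ i = f _ (nonzero i)
    f′-injective : ∀ {i j} → f′ i ≡ f′ j → i ≡ j
    f′-injective eq = punchIn-injective (to 0#) _ _
      (trans (sym (strictlyInverseˡ _)) (trans (cong to (f-injective _ _ eq)) (strictlyInverseˡ _)))

  powers-collide : ∀ {n g} → Carrier ↔ Fin n → g ≢ 0# → ∃[ a ] ∃[ b ] (a < b × b ≤ n ∸ 1 × g ^ a ≡ g ^ b)
  powers-collide {zero} ι _ = ⊥-elim (¬Fin0 (Inverse.to ι 0#))
  powers-collide {suc n} {g} ι g≢0 = collide (pigeonhole (n<1+n n) f)
    where
    to0≢ : ∀ (i : Fin (suc n)) → Inverse.to ι 0# ≢ Inverse.to ι (g ^ toℕ i)
    to0≢ i eq = ^≢0 (toℕ i) g≢0 (sym (to-injective ι eq))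
    f : Fin (suc n) → Fin n
    f i = punchOut (to0≢ i)
    collide : (∃[ i ] ∃[ j ] (toℕ i < toℕ j × f i ≡ f j)) → ∃[ a ] ∃[ b ] (a < b × b ≤ suc n ∸ 1 × g ^ a ≡ g ^ b)
    collide (i , j , i<j , eq) =
      toℕ i , toℕ j , i<j , toℕ≤pred[n] j , to-injective ι (punchOut-injective (to0≢ i) (to0≢ j) eq)

  0<size∸1 : 0 < size ∸ 1
  0<size∸1 with powers-collide enum 1≢0
  ... | _ , _ , a<b , b≤size∸1 , _ = ℕ.<-≤-trans (ℕ.≤-<-trans z≤n a<b) b≤size∸1

  module Generator {ζ} (generates : IsGenerator ζ) (1<size∸1 : 1 < size ∸ 1) where

    -- 0 vacuously generates F₂* = {1}; the hypothesis on the size excludes this.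
    ζ≢0 : ζ ≢ 0#
    ζ≢0 ζ≡0 with ℕ.≤-trans 1<size∸1 (nonzero-injection⇒≤ {e = 1} enum (λ _ _ → Fin.zero)
      λ x≢0 y≢0 _ → trans (≡1 x≢0) (sym (≡1 y≢0)))
      where
      ≡1 : ∀ {x} → x ≢ 0# → x ≡ 1#
      ≡1 {x} x≢0 with generates x x≢0
      ... | zero , x≡1 = x≡1
      ... | suc n , x≡ζⁿ⁺¹ = contradiction (trans x≡ζⁿ⁺¹ (trans (cong (_* ζ ^ n) ζ≡0) (zeroˡ (ζ ^ n)))) x≢0
    ... | s≤s ()

    size∸1≤ : ∀ {e} → 0 < e → ζ ^ e ≡ 1# → size ∸ 1 ≤ e
    size∸1≤ {e} 0<e ζᵉ≡1 = nonzero-injection⇒≤ enum (λ x x≢0 → fromℕ< (m%n<n (log x x≢0) e)) injective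
      where
      instance
        e≢0 : NonZero e
        e≢0 = >-nonZero 0<e
      log : ∀ x → x ≢ 0# → ℕ
      log x x≢0 = proj₁ (generates x x≢0)
      injective : ∀ {x y} x≢0 y≢0 → fromℕ< (m%n<n (log x x≢0) e) ≡ fromℕ< (m%n<n (log y y≢0) e) → x ≡ y
      injective {x} {y} x≢0 y≢0 eq = begin
        x                          ≡⟨ proj₂ (generates x x≢0) ⟩
        ζ ^ log x x≢0              ≡⟨ ^-mod ζᵉ≡1 (log x x≢0) ⟩
        ζ ^ (log x x≢0 % e)        ≡⟨ cong (ζ ^_) (trans (sym (toℕ-fromℕ< _)) (trans (cong toℕ eq) (toℕ-fromℕ< _))) ⟩
        ζ ^ (log y y≢0 % e)        ≡⟨ ^-mod ζᵉ≡1 (log y y≢0) ⟨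
        ζ ^ log y y≢0              ≡⟨ proj₂ (generates y y≢0) ⟨
        y                          ∎

    generator-hasOrder : HasOrder ζ (size ∸ 1)
    generator-hasOrder with powers-collide enum ζ≢0
    ... | a , b , a<b , b≤size∸1 , ζᵃ≡ζᵇ = record
      { 0<o     = 0<size∸1
      ; ^o≡1    = subst (λ e → ζ ^ e ≡ 1#) b∸a≡size∸1 ζᵇ⁻ᵃ≡1
      ; minimal = λ 0<e e<size∸1 ζᵉ≡1 → <-irrefl refl (<-≤-trans e<size∸1 (size∸1≤ 0<e ζᵉ≡1))
      }
      where
      ζᵇ⁻ᵃ≡1 : ζ ^ (b ∸ a) ≡ 1#
      ζᵇ⁻ᵃ≡1 = ^-cancel ζ≢0 (<⇒≤ a<b) ζᵃ≡ζᵇ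
      b∸a≡size∸1 : b ∸ a ≡ size ∸ 1
      b∸a≡size∸1 = ≤-antisym (≤-trans (m∸n≤m b a) b≤size∸1) (size∸1≤ (m<n⇒0<n∸m a<b) ζᵇ⁻ᵃ≡1)

    open HasOrderProperties generator-hasOrder using (even-order⇒-1≢1; odd-order⇒-1≡1)

    -1≡1⇔2∣size : - 1# ≡ 1# ⇔ 2 ∣ size
    -1≡1⇔2∣size = mk⇔
      (λ -1≡1 → subst (2 ∣_) 1+[size∸1]≡size (Equivalence.from (2∣suc⇔¬2∣ _) (λ 2∣ → even-order⇒-1≢1 2∣ -1≡1)))
      (λ 2∣size → odd-order⇒-1≡1 (Equivalence.to (2∣suc⇔¬2∣ _) (subst (2 ∣_) (sym 1+[size∸1]≡size) 2∣size))
                                 (proj₁ (generates (- 1#) -1≢0)) (sym (proj₂ (generates (- 1#) -1≢0))))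
      where
      1+[size∸1]≡size : suc (size ∸ 1) ≡ size
      1+[size∸1]≡size = m+[n∸m]≡n (≤-trans 0<size∸1 (m∸n≤m size 1))

    characteristic : ∀ {p} r → Prime p → size ≡ p ℕ.^ r → - 1# ≡ 1# ⇔ p ≡ 2
    characteristic zero _ size≡1 = contradiction (subst (λ n → 0 < n ∸ 1) size≡1 0<size∸1) λ ()
    characteristic (suc r) p-prime size≡pʳ⁺¹ = mk⇔
      (Equivalence.to (2∣prime^⇔≡2 p-prime r) ∘ subst (2 ∣_) size≡pʳ⁺¹ ∘ Equivalence.to -1≡1⇔2∣size)
      (Equivalence.from -1≡1⇔2∣size ∘ subst (2 ∣_) (sym size≡pʳ⁺¹) ∘ Equivalence.from (2∣prime^⇔≡2 p-prime r))

  -- The intersections (Φ + 1) ∩ (Φ + φʲ)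

  AtMostTwo : Pred Carrier 0ℓ → Set
  AtMostTwo S = ∀ {x y z} → S x → S y → S z → x ≢ y → x ≢ z → y ≢ z → ⊥

  AtMostTwo⇒≡⊎≡ : ∀ {S} → AtMostTwo S → ∀ {a b x} → S a → S b → a ≢ b → S x → x ≡ a ⊎ x ≡ b
  AtMostTwo⇒≡⊎≡ two {a} {b} {x} Sa Sb a≢b Sx with x ≟ a | x ≟ b
  ... | yes x≡a | _ = inj₁ x≡a
  ... | no _ | yes x≡b = inj₂ x≡b
  ... | no x≢a | no x≢b = ⊥-elim (two Sa Sb Sx a≢b (x≢a ∘ sym) (x≢b ∘ sym))

  module _ {φ k} (φ-order : HasOrder φ k) where
    open HasOrder φ-order
    open HasOrderProperties φ-order
    open Cyclic φ k

    ∈Coset : ∀ n {a c x} → x ≡ φ ^ n * a + c → Coset a c x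
    ∈Coset n {a} {c} {x} x≡φⁿa+c = fromℕ< (m%n<n n k) , (begin
      x                                      ≡⟨ x≡φⁿa+c ⟩
      φ ^ n * a + c                          ≡⟨ cong (λ z → z * a + c) (^-mod ^o≡1 n) ⟩
      φ ^ (n % k) * a + c                    ≡⟨ cong (λ e → φ ^ e * a + c) (toℕ-fromℕ< (m%n<n n k)) ⟨
      φ ^ toℕ (fromℕ< (m%n<n n k)) * a + c   ∎)

    ∈Φ+ : ∀ n {c x} → x ≡ φ ^ n + c → Coset 1# c x
    ∈Φ+ n {c} x≡φⁿ+c = ∈Coset n (trans x≡φⁿ+c (cong (_+ c) (sym (*-identityʳ (φ ^ n)))))

    ∈Φ+⁻ : ∀ {c x} → Coset 1# c x → ∃[ n ] x ≡ φ ^ n + c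
    ∈Φ+⁻ {c} (t , x≡) = toℕ t , trans x≡ (cong (_+ c) (*-identityʳ _))

    circular⇒AtMostTwo : Circular → ∀ {a b c} → a ≢ 0# → b ≢ 0# → c ≢ 0# → AtMostTwo (Coset a 0# ∩ Coset b c)
    circular⇒AtMostTwo circular {a} {b} {c} a≢0 b≢0 c≢0 Sx Sy Sz x≢y x≢z y≢z
      with ≤-trans (3≤card (Coset? a 0# ∩? Coset? b c) Sx Sy Sz x≢y x≢z y≢z) (circular a b c a≢0 b≢0 c≢0)
    ... | s≤s (s≤s ())

    φⁿ⁺ᵘ≡-φⁿ : ∀ {u} → φ ^ u ≡ - 1# → ∀ n → φ ^ (n ℕ.+ u) ≡ - (φ ^ n)
    φⁿ⁺ᵘ≡-φⁿ {u} φᵘ≡-1 n = trans (^-homo-* φ n u) (trans (cong (φ ^ n *_) φᵘ≡-1) (x*-1≡-x (φ ^ n)))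

    -1∈Φ : Set
    -1∈Φ = ∃[ u ] φ ^ u ≡ - 1#

    φᵃ≡-φᵇ⇒-1∈Φ : ∀ a b → b ≤ k → φ ^ a ≡ - (φ ^ b) → -1∈Φ
    φᵃ≡-φᵇ⇒-1∈Φ a b b≤k φᵃ≡-φᵇ = a ℕ.+ (k ∸ b) , (begin
      φ ^ (a ℕ.+ (k ∸ b))             ≡⟨ ^-homo-* φ a (k ∸ b) ⟩
      φ ^ a * φ ^ (k ∸ b)             ≡⟨ cong (_* φ ^ (k ∸ b)) φᵃ≡-φᵇ ⟩
      - (φ ^ b) * φ ^ (k ∸ b)         ≡⟨ -‿distribˡ-* (φ ^ b) (φ ^ (k ∸ b)) ⟨
      - (φ ^ b * φ ^ (k ∸ b))         ≡⟨ cong -_ (^-homo-* φ b (k ∸ b)) ⟨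
      - (φ ^ (b ℕ.+ (k ∸ b)))         ≡⟨ cong (λ e → - (φ ^ e)) (m+[n∸m]≡n b≤k) ⟩
      - (φ ^ k)                       ≡⟨ cong -_ ^o≡1 ⟩
      - 1#                            ∎)

    Φ∩[x-Φ] : Carrier → Pred Carrier 0ℓ
    Φ∩[x-Φ] x = Coset 1# 0# ∩ Coset (- 1#) x

    summand∈Φ∩[x-Φ] : ∀ a b {x} → x ≡ φ ^ a + φ ^ b → Φ∩[x-Φ] x (φ ^ a)
    summand∈Φ∩[x-Φ] a b x≡φᵃ+φᵇ =
      ∈Φ+ a (sym (+-identityʳ (φ ^ a))) ,
      ∈Coset b (sym (trans (cong₂ _+_ (x*-1≡-x (φ ^ b)) x≡φᵃ+φᵇ) (-y+[x+y]≡x (φ ^ a) (φ ^ b))))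

    c : ℕ → ℕ → Carrier
    c j i = ((φ ^ j) - 1#) ⁻¹ * ((φ ^ i) - 1#)

    OneIn : Carrier → Set
    OneIn x = Coset x 0# 1#

    module Intersection (circular : Circular) {j} (1≤j : 1 ≤ j) (j<k : j < k) where

      Inter : Pred Carrier 0ℓ
      Inter = Coset 1# 1# ∩ Coset 1# (φ ^ j)

      Inter? : Decidable Inter
      Inter? = Coset? 1# 1# ∩? Coset? 1# (φ ^ j)

      N : ℕ
      N = cardInter 1# 1# 1# (φ ^ j)

      φʲ≢1 : φ ^ j ≢ 1#
      φʲ≢1 = minimal 1≤j j<k

      φʲ-1≢0 : φ ^ j - 1# ≢ 0#
      φʲ-1≢0 = φʲ≢1 ∘ x∙y⁻¹≈ε⇒x≈y (φ ^ j) 1#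

      φʲ+1∈Inter : Inter (φ ^ j + 1#)
      φʲ+1∈Inter = ∈Φ+ j refl , ∈Φ+ 0 (+-comm (φ ^ j) 1#)

      0∈Inter : -1∈Φ → Inter 0#
      0∈Inter (u , φᵘ≡-1) =
        ∈Φ+ u (sym (trans (cong (_+ 1#) φᵘ≡-1) (-‿inverseˡ 1#))) ,
        ∈Φ+ (j ℕ.+ u) (sym (trans (cong (_+ φ ^ j) (φⁿ⁺ᵘ≡-φⁿ φᵘ≡-1 j)) (-‿inverseˡ (φ ^ j))))

      Inter-AtMostTwo : AtMostTwo Inter
      Inter-AtMostTwo x∈ y∈ z∈ x≢y x≢z y≢z =
        circular⇒AtMostTwo circular 1≢0 1≢0 φʲ-1≢0 (shift x∈) (shift y∈) (shift z∈)
          (x≢y ∘ +-cancelʳ (- 1#) _ _) (x≢z ∘ +-cancelʳ (- 1#) _ _) (y≢z ∘ +-cancelʳ (- 1#) _ _)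
        where
        shift : ∀ {x} → Inter x → (Coset 1# 0# ∩ Coset 1# (φ ^ j - 1#)) (x - 1#)
        shift ((s , x≡) , (t , x≡′)) =
          (s , trans (cong (_- 1#) x≡) (trans (+-assoc _ 1# (- 1#)) (cong (φ ^ toℕ s * 1# +_) (-‿inverseʳ 1#)))) ,
          (t , trans (cong (_- 1#) x≡′) (+-assoc _ (φ ^ j) (- 1#)))

      -φʲ≡1 : φ ^ j ≡ - 1# → - (φ ^ j) ≡ 1#
      -φʲ≡1 φʲ≡-1 = trans (cong -_ φʲ≡-1) (-‿involutive 1#)

      neg∈Inter : φ ^ j ≡ - 1# → ∀ {x} → Inter x → Inter (- x)
      neg∈Inter φʲ≡-1 {x} (x∈Φ+1 , x∈Φ+φʲ) with ∈Φ+⁻ x∈Φ+1 | ∈Φ+⁻ x∈Φ+φʲ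
      ... | s , x≡φˢ+1 | t , x≡φᵗ+φʲ =
        ∈Φ+ (t ℕ.+ j) (begin
          - x                      ≡⟨ cong -_ x≡φᵗ+φʲ ⟩
          - (φ ^ t + φ ^ j)        ≡⟨ -‿+-comm (φ ^ t) (φ ^ j) ⟨
          - (φ ^ t) + - (φ ^ j)    ≡⟨ cong₂ _+_ (sym (φⁿ⁺ᵘ≡-φⁿ φʲ≡-1 t)) (-φʲ≡1 φʲ≡-1) ⟩
          φ ^ (t ℕ.+ j) + 1#       ∎) ,
        ∈Φ+ (s ℕ.+ j) (begin
          - x                      ≡⟨ cong -_ x≡φˢ+1 ⟩
          - (φ ^ s + 1#)           ≡⟨ -‿+-comm (φ ^ s) 1# ⟨
          - (φ ^ s) + - 1#         ≡⟨ cong₂ _+_ (sym (φⁿ⁺ᵘ≡-φⁿ φʲ≡-1 s)) (sym φʲ≡-1) ⟩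
          φ ^ (s ℕ.+ j) + φ ^ j    ∎)

      ∈Inter⇒≡0 : φ ^ j ≡ - 1# → ∀ {x} → Inter x → x ≡ 0#
      ∈Inter⇒≡0 φʲ≡-1 {x} x∈ with x ≟ 0#
      ... | yes x≡0 = x≡0
      ... | no x≢0 = ⊥-elim (Inter-AtMostTwo (0∈Inter (j , φʲ≡-1)) x∈ (neg∈Inter φʲ≡-1 x∈) (x≢0 ∘ sym) 0≢-x x≢-x)
        where
        0≢-x : 0# ≢ - x
        0≢-x 0≡-x = x≢0 (trans (sym (-‿involutive x)) (trans (cong -_ (sym 0≡-x)) -0#≈0#))
        x≢-x : x ≢ - x
        x≢-x x≡-x = x≢0 (x+x≡y+y⇒x≡y (φʲ≢1 ∘ trans φʲ≡-1)
          (trans (cong (x +_) x≡-x) (trans (-‿inverseʳ x) (sym (+-identityʳ 0#)))))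

      φʲ+1≢0 : φ ^ j ≢ - 1# → φ ^ j + 1# ≢ 0#
      φʲ+1≢0 φʲ≢-1 = φʲ≢-1 ∘ +-inverseˡ-unique (φ ^ j) 1#

      ∈Inter⇒≡φʲ+1⊎≡0 : -1∈Φ → ∀ {x} → Inter x → x ≡ φ ^ j + 1# ⊎ x ≡ 0#
      ∈Inter⇒≡φʲ+1⊎≡0 -1∈Φ x∈ with (φ ^ j) ≟ (- 1#)
      ... | yes φʲ≡-1 = inj₂ (∈Inter⇒≡0 φʲ≡-1 x∈)
      ... | no φʲ≢-1 = AtMostTwo⇒≡⊎≡ Inter-AtMostTwo φʲ+1∈Inter (0∈Inter -1∈Φ) (φʲ+1≢0 φʲ≢-1) x∈

      -1∈Φ⇒N≡2 : -1∈Φ → φ ^ j ≢ - 1# → N ≡ 2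
      -1∈Φ⇒N≡2 -1∈Φ φʲ≢-1 = card-pair Inter? (φʲ+1≢0 φʲ≢-1)
        (∈Inter⇒≡φʲ+1⊎≡0 -1∈Φ , λ { (inj₁ refl) → φʲ+1∈Inter ; (inj₂ refl) → 0∈Inter -1∈Φ })

      φʲ≡-1⇒N≡1 : φ ^ j ≡ - 1# → N ≡ 1
      φʲ≡-1⇒N≡1 φʲ≡-1 = card-singleton Inter? (∈Inter⇒≡0 φʲ≡-1 , λ { refl → 0∈Inter (j , φʲ≡-1) })

      -- φˢ, 1, φᵗ, φʲ all lie in Φ ∩ (x - Φ); unless φˢ = φʲ three of them are distinct.
      decompositions-agree : - 1# ≢ 1# → ∀ {x} s t → AtMostTwo (Φ∩[x-Φ] x) →
                             x ≡ φ ^ s + 1# → x ≡ φ ^ t + φ ^ j → φ ^ s ≡ φ ^ j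
      decompositions-agree -1≢1 {x} s t two x≡φˢ+1 x≡φᵗ+φʲ with (φ ^ s) ≟ (φ ^ j) | (φ ^ s) ≟ 1#
      ... | yes φˢ≡φʲ | _ = φˢ≡φʲ
      ... | no φˢ≢φʲ | no φˢ≢1 = ⊥-elim (two
        (summand∈Φ∩[x-Φ] s 0 x≡φˢ+1)
        (summand∈Φ∩[x-Φ] 0 s (trans x≡φˢ+1 (+-comm (φ ^ s) 1#)))
        (summand∈Φ∩[x-Φ] j t (trans x≡φᵗ+φʲ (+-comm (φ ^ t) (φ ^ j))))
        φˢ≢1 φˢ≢φʲ (φʲ≢1 ∘ sym))
      ... | no φˢ≢φʲ | yes φˢ≡1 = ⊥-elim (two
        (summand∈Φ∩[x-Φ] 0 0 x≡1+1) (summand∈Φ∩[x-Φ] j t x≡φʲ+φᵗ) (summand∈Φ∩[x-Φ] t j x≡φᵗ+φʲ)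
        (φʲ≢1 ∘ sym)
        (λ 1≡φᵗ → φʲ≢1 (+-cancelʳ 1# (φ ^ j) 1# (trans (cong (φ ^ j +_) 1≡φᵗ) φʲ+φᵗ≡1+1)))
        (λ φʲ≡φᵗ → φʲ≢1 (x+x≡y+y⇒x≡y -1≢1 (trans (cong (φ ^ j +_) φʲ≡φᵗ) φʲ+φᵗ≡1+1))))
        where
        x≡1+1 : x ≡ 1# + 1#
        x≡1+1 = trans x≡φˢ+1 (cong (_+ 1#) φˢ≡1)
        x≡φʲ+φᵗ : x ≡ φ ^ j + φ ^ t
        x≡φʲ+φᵗ = trans x≡φᵗ+φʲ (+-comm (φ ^ t) (φ ^ j))
        φʲ+φᵗ≡1+1 : φ ^ j + φ ^ t ≡ 1# + 1#
        φʲ+φᵗ≡1+1 = trans (sym x≡φʲ+φᵗ) x≡1+1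

      ∈Inter⇒≡φʲ+1 : ¬ -1∈Φ → ∀ {x} → Inter x → x ≡ φ ^ j + 1#
      ∈Inter⇒≡φʲ+1 -1∉Φ {x} (x∈Φ+1 , x∈Φ+φʲ) with ∈Φ+⁻ x∈Φ+1 | ∈Φ+⁻ x∈Φ+φʲ
      ... | s , x≡φˢ+1 | t , x≡φᵗ+φʲ = trans x≡φˢ+1 (cong (_+ 1#) (decompositions-agree -1≢1 s t
        (circular⇒AtMostTwo circular 1≢0 -1≢0 x≢0) x≡φˢ+1 x≡φᵗ+φʲ))
        where
        -1≢1 : - 1# ≢ 1#
        -1≢1 -1≡1 = -1∉Φ (0 , sym -1≡1)
        x≢0 : x ≢ 0#
        x≢0 x≡0 = -1∉Φ (φᵃ≡-φᵇ⇒-1∈Φ t j (<⇒≤ j<k) (+-inverseˡ-unique (φ ^ t) (φ ^ j) (trans (sym x≡φᵗ+φʲ) x≡0)))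

      ¬-1∈Φ⇒N≡1 : ¬ -1∈Φ → N ≡ 1
      ¬-1∈Φ⇒N≡1 -1∉Φ = card-singleton Inter? (∈Inter⇒≡φʲ+1 -1∉Φ , λ { refl → φʲ+1∈Inter })

      OneIn⇒solution : ∀ i → OneIn (c j i) → ∃[ t ] φ ^ t * (φ ^ i - 1#) ≡ φ ^ j - 1#
      OneIn⇒solution i (t , 1≡) = toℕ t , a*[x⁻¹*y]≡1⇒a*y≡x φʲ-1≢0 (sym (trans 1≡ (+-identityʳ _)))

      OneIn-c-self : OneIn (c j j)
      OneIn-c-self = ∈Coset 0 (sym (trans (+-identityʳ _) (trans (*-identityˡ _) (x⁻¹*x≡1 φʲ-1≢0))))

      solution-point : ∀ t i → φ ^ t * (φ ^ i - 1#) ≡ φ ^ j - 1# → φ ^ (t ℕ.+ i) + 1# ≡ φ ^ t + φ ^ j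
      solution-point t i eq = begin
        φ ^ (t ℕ.+ i) + 1#     ≡⟨ cong (_+ 1#) (^-homo-* φ t i) ⟩
        φ ^ t * φ ^ i + 1#     ≡⟨ a-b≡c-d⇒a+d≡b+c (begin
          φ ^ t * φ ^ i - φ ^ t          ≡⟨ cong (λ z → φ ^ t * φ ^ i - z) (*-identityʳ (φ ^ t)) ⟨
          φ ^ t * φ ^ i - φ ^ t * 1#     ≡⟨ x[y-z]≈xy-xz (φ ^ t) (φ ^ i) 1# ⟨
          φ ^ t * (φ ^ i - 1#)           ≡⟨ eq ⟩
          φ ^ j - 1#                     ∎) ⟩
        φ ^ t + φ ^ j          ∎

      solution∈Inter : ∀ t i → φ ^ t * (φ ^ i - 1#) ≡ φ ^ j - 1# → Inter (φ ^ t + φ ^ j)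
      solution∈Inter t i eq = ∈Φ+ (t ℕ.+ i) (sym (solution-point t i eq)) , ∈Φ+ t refl

      -- The point φᵗ + φʲ of Inter is φʲ + 1 or 0, and either way φᵗ = 1.
      solution-trivial : -1∈Φ → ∀ t i → φ ^ i ≡ - 1# ⊎ φ ^ j ≡ - 1# →
                         φ ^ t * (φ ^ i - 1#) ≡ φ ^ j - 1# → φ ^ i ≡ φ ^ j
      solution-trivial -1∈Φ t i φⁱ≡-1⊎φʲ≡-1 eq = +-cancelʳ (- 1#) (φ ^ i) (φ ^ j) (begin
        φ ^ i - 1#              ≡⟨ *-identityˡ (φ ^ i - 1#) ⟨
        1# * (φ ^ i - 1#)
          ≡⟨ cong (_* (φ ^ i - 1#)) (φᵗ≡1 (∈Inter⇒≡φʲ+1⊎≡0 -1∈Φ (solution∈Inter t i eq)) φⁱ≡-1⊎φʲ≡-1) ⟨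
        φ ^ t * (φ ^ i - 1#)    ≡⟨ eq ⟩
        φ ^ j - 1#              ∎)
        where
        φᵗ≡1 : φ ^ t + φ ^ j ≡ φ ^ j + 1# ⊎ φ ^ t + φ ^ j ≡ 0# → φ ^ i ≡ - 1# ⊎ φ ^ j ≡ - 1# → φ ^ t ≡ 1#
        φᵗ≡1 (inj₁ φᵗ+φʲ≡φʲ+1) _ = +-cancelʳ (φ ^ j) (φ ^ t) 1# (trans φᵗ+φʲ≡φʲ+1 (+-comm (φ ^ j) 1#))
        φᵗ≡1 (inj₂ φᵗ+φʲ≡0) (inj₂ φʲ≡-1) = trans (+-inverseˡ-unique (φ ^ t) (φ ^ j) φᵗ+φʲ≡0) (-φʲ≡1 φʲ≡-1)
        φᵗ≡1 (inj₂ φᵗ+φʲ≡0) (inj₁ φⁱ≡-1) = sym (trans (+-inverseʳ-unique (- (φ ^ t)) 1# (begin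
          - (φ ^ t) + 1#         ≡⟨ cong (_+ 1#) (φⁿ⁺ᵘ≡-φⁿ φⁱ≡-1 t) ⟨
          φ ^ (t ℕ.+ i) + 1#     ≡⟨ solution-point t i eq ⟩
          φ ^ t + φ ^ j          ≡⟨ φᵗ+φʲ≡0 ⟩
          0#                     ∎)) (-‿involutive (φ ^ t)))

      even-case : (h : ℕ) → k ≡ 2 ℕ.* h →
          ((∃[ i ] (1 ≤ i × i < k × i ≢ h × OneIn (c j i))) → N ≡ 2)
        × (OneIn (c j h) → N ≡ 1)
        × (¬ (∃[ i ] (1 ≤ i × i < k × i ≢ h × OneIn (c j i))) → ¬ OneIn (c j h) → N ≡ 0)
      even-case h k≡2h = some-i≢h , at-h , neither
        where
        φʰ≡-1 : φ ^ h ≡ - 1#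
        φʰ≡-1 = ^half≡-1 h k≡2h
        h<k : h < k
        h<k = proj₂ (n≡2*h⇒0<h<n h 0<o k≡2h)
        some-i≢h : (∃[ i ] (1 ≤ i × i < k × i ≢ h × OneIn (c j i))) → N ≡ 2
        some-i≢h (i , _ , i<k , i≢h , one) with OneIn⇒solution i one
        ... | t , eq = -1∈Φ⇒N≡2 (h , φʰ≡-1) λ φʲ≡-1 →
          i≢h (^-injective i<k h<k (trans (solution-trivial (h , φʰ≡-1) t i (inj₂ φʲ≡-1) eq) (trans φʲ≡-1 (sym φʰ≡-1))))
        at-h : OneIn (c j h) → N ≡ 1
        at-h one with OneIn⇒solution h one
        ... | t , eq = φʲ≡-1⇒N≡1 (trans (sym (solution-trivial (h , φʰ≡-1) t h (inj₁ φʰ≡-1) eq)) φʰ≡-1)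
        neither : ¬ (∃[ i ] (1 ≤ i × i < k × i ≢ h × OneIn (c j i))) → ¬ OneIn (c j h) → N ≡ 0
        neither no-i≢h not-at-h with j ℕ.≟ h
        ... | yes refl = contradiction OneIn-c-self not-at-h
        ... | no j≢h = contradiction (j , 1≤j , j<k , j≢h , OneIn-c-self) no-i≢h

      odd-case : ¬ 2 ∣ k →
          (- 1# ≡ 1# → N ≡ 2)
        × (- 1# ≢ 1# → N ≡ 1)
        × (¬ (∃[ i ] (1 ≤ i × i < k × OneIn (c j i))) → N ≡ 0)
      odd-case k-odd =
          (λ -1≡1 → -1∈Φ⇒N≡2 (0 , sym -1≡1) (λ φʲ≡-1 → φʲ≢1 (trans φʲ≡-1 -1≡1)))
        , (λ -1≢1 → ¬-1∈Φ⇒N≡1 λ (n , φⁿ≡-1) → -1≢1 (odd-order⇒-1≡1 k-odd n φⁿ≡-1))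
        , (λ no-i → contradiction (j , 1≤j , j<k , OneIn-c-self) no-i)

lemma19 : (F : FiniteField) → let open FiniteField F in
    (p r : ℕ) → Prime p → size ≡ p ℕ.^ r →
    (k : ℕ) → 3 ≤ k → (m : ℕ) → size ∸ 1 ≡ m ℕ.* k →
    (ζ : Carrier) → IsGenerator ζ →
    let φ = ζ ^ m
        open Cyclic φ k
        c : ℕ → ℕ → Carrier
        c j i = ((φ ^ j) - 1#) ⁻¹ * ((φ ^ i) - 1#)
        N : ℕ → ℕ
        N j = cardInter 1# 1# 1# (φ ^ j)
        OneIn : Carrier → Set
        OneIn x = Coset x 0# 1#
    in Circular → (j : ℕ) → 1 ≤ j → j < k →
    ((h : ℕ) → k ≡ 2 ℕ.* h →
        ((∃[ i ] (1 ≤ i × i < k × i ≢ h × OneIn (c j i))) → N j ≡ 2)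
      × (OneIn (c j h) → N j ≡ 1)
      × (¬ (∃[ i ] (1 ≤ i × i < k × i ≢ h × OneIn (c j i))) → ¬ OneIn (c j h) → N j ≡ 0))
    × (¬ (2 ∣ k) →
        (p ≡ 2 → (∃[ i ] (1 ≤ i × i < k × OneIn (c j i))) → N j ≡ 2)
      × (p ≢ 2 → (∃[ i ] (1 ≤ i × i < k × OneIn (c j i))) → N j ≡ 1)
      × (¬ (∃[ i ] (1 ≤ i × i < k × OneIn (c j i))) → N j ≡ 0))
lemma19 F p r p-prime size≡pʳ k 3≤k m size∸1≡mk ζ generates circular j 1≤j j<k =
  even-case , λ k-odd → let (char-2 , char≢2 , none) = odd-case k-odd in
    (λ p≡2 _ → char-2 (from p≡2)) , (λ p≢2 _ → char≢2 (p≢2 ∘ to)) , none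
  where
  open FiniteField F
  open FiniteFieldProperties F
  instance
    size∸1≢0 : NonZero (size ∸ 1)
    size∸1≢0 = >-nonZero 0<size∸1
  open Generator generates (≤-trans (<⇒≤ 3≤k) (∣⇒≤ (divides m size∸1≡mk)))
  open Intersection (HasOrderProperties.^-hasOrder generator-hasOrder m size∸1≡mk) circular 1≤j j<k
  open Equivalence (characteristic r p-prime size≡pʳ)
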